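{- Let $\mathcal{M}=\langle \mathbf{A},\mathbf{B},f,i\rangle$ be a FIDL-module, let $G$ be a filter of $\mathbf{A}$ and $H$ a filter of $\mathbf{B}$. Then the sets $f(G,H)=\{x\in A : \exists (g,h)\in G\times H \text{ with } f(g,h)\le x\}$ and $i(H,G)=\{x\in A : \exists (h,g)\in H\times G \text{ with } g\le i(h,x)\}$ are filters of $\mathbf{A}$.
   Context: A FIDL-module is a structure $\mathcal{M}=\langle \mathbf{A},\mathbf{B},f,i\rangle$ where $\mathbf{A},\mathbf{B}$ are bounded distributive lattices and $f\colon A\times B\to A$, $i\colon B\times A\to A$ are functions such that for all $x,y\in A$, $b,c\in B$: $f(x\vee y,b)=f(x,b)\vee f(y,b)$; $f(x,b\vee c)=f(x,b)\vee f(x,c)$; $f(0,b)=0$; $f(x,0)=0$; $i(b,x\wedge y)=i(b,x)\wedge i(b,y)$; $i(b\vee c,x)=i(b,x)\wedge i(c,x)$; $i(b,1)=1$. A filter of a bounded lattice is a nonempty increasing subset containing $1$ and closed under $\wedge$. -}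

module Defs where

open import Level using (Level; _⊔_; suc)
open import Data.Product using (Σ; ∃; _×_; _,_)
open import Algebra.Lattice.Bundles using (DistributiveLattice)

record BoundedDistributiveLattice (c ℓ : Level) : Set (suc (c ⊔ ℓ)) where
  field
    distributiveLattice : DistributiveLattice c ℓ
  open DistributiveLattice distributiveLattice public
  field
    ⊤ : Carrier
    ⊥ : Carrier
    ∧-identityʳ : ∀ x → (x ∧ ⊤) ≈ x
    ∨-identityʳ : ∀ x → (x ∨ ⊥) ≈ x

  _≤_ : Carrier → Carrier → Set ℓ
  x ≤ y = (x ∧ y) ≈ x

record IsFilter {c ℓ p : Level} (L : BoundedDistributiveLattice c ℓ)
                (F : BoundedDistributiveLattice.Carrier L → Set p)
                : Set (c ⊔ ℓ ⊔ p) where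
  open BoundedDistributiveLattice L
  field
    nonempty   : ∃ λ x → F x
    contains-⊤ : F ⊤
    increasing : ∀ {x y} → x ≤ y → F x → F y
    ∧-closed   : ∀ {x y} → F x → F y → F (x ∧ y)

-- FIDL-modules. Since the lattices are setoids, f and i are required to
-- respect the lattice equality (they are genuine functions in the paper).
record FIDLModule (a ℓa b ℓb : Level) : Set (suc (a ⊔ ℓa ⊔ b ⊔ ℓb)) where
  field
    𝐀 : BoundedDistributiveLattice a ℓa
    𝐁 : BoundedDistributiveLattice b ℓb
  module A = BoundedDistributiveLattice 𝐀
  module B = BoundedDistributiveLattice 𝐁
  field
    f : A.Carrier → B.Carrier → A.Carrier
    i : B.Carrier → A.Carrier → A.Carrier
    f-cong : ∀ {x y b c} → x A.≈ y → b B.≈ c → f x b A.≈ f y c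
    i-cong : ∀ {b c x y} → b B.≈ c → x A.≈ y → i b x A.≈ i c y
    f-∨ˡ : ∀ x y b → f (x A.∨ y) b A.≈ (f x b A.∨ f y b)
    f-∨ʳ : ∀ x b c → f x (b B.∨ c) A.≈ (f x b A.∨ f x c)
    f-⊥ˡ : ∀ b → f A.⊥ b A.≈ A.⊥
    f-⊥ʳ : ∀ x → f x B.⊥ A.≈ A.⊥
    i-∧ʳ : ∀ b x y → i b (x A.∧ y) A.≈ (i b x A.∧ i b y)
    i-∨ˡ : ∀ b c x → i (b B.∨ c) x A.≈ (i b x A.∧ i c x)
    i-⊤ : ∀ b → i b A.⊤ A.≈ A.⊤

  fImage : ∀ {p q} → (A.Carrier → Set p) → (B.Carrier → Set q)
         → A.Carrier → Set (a ⊔ b ⊔ ℓa ⊔ p ⊔ q)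
  fImage G H x = Σ A.Carrier λ g → Σ B.Carrier λ h → G g × H h × (f g h A.≤ x)

  iImage : ∀ {p q} → (B.Carrier → Set q) → (A.Carrier → Set p)
         → A.Carrier → Set (a ⊔ b ⊔ ℓa ⊔ p ⊔ q)
  iImage H G x = Σ B.Carrier λ h → Σ A.Carrier λ g → H h × G g × (g A.≤ i h x)

-- f is monotone in both arguments, because it preserves joins in each; so
-- f(g₁ ∧ g₂, h₁ ∧ h₂) lies below both f(g₁, h₁) and f(g₂, h₂), and f(G, H) is
-- closed under meets.  Dually i is monotone in its second argument and
-- antitone in its first (it turns joins into meets), so a common lower bound
-- of i(h₁, x) and i(h₂, y) is a lower bound of i(h₁ ∧ h₂, x) ∧ i(h₁ ∧ h₂, y),
-- which is i(h₁ ∧ h₂, x ∧ y).  Both sets contain ⊤ since ⊤ is the top and i(h, ⊤) = ⊤.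
module Submission where

open import Defs
open import Level using (Level)
open import Data.Product using (_×_; _,_)
open import Algebra.Lattice.Bundles using (Lattice)
import Algebra.Lattice.Properties.Lattice as LatticeProperties
import Relation.Binary.Lattice.Bundles as OrderTheoretic

module LatticeOrder {c ℓ} (L : Lattice c ℓ) where
  open Lattice L

  infix 4 _≤_
  _≤_ : Carrier → Carrier → Set ℓ
  x ≤ y = (x ∧ y) ≈ x

  -- The library's order is x ≈ x ∧ y; ours is its symmetric form.
  private
    module O = OrderTheoretic.Lattice (LatticeProperties.∨-∧-orderTheoreticLattice L)

  ≤-trans : ∀ {x y z} → x ≤ y → y ≤ z → x ≤ z
  ≤-trans x≤y y≤z = sym (O.trans (sym x≤y) (sym y≤z))

  ≤-respʳ-≈ : ∀ {x y z} → y ≈ z → x ≤ y → x ≤ z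
  ≤-respʳ-≈ y≈z x≤y = sym (O.≤-respʳ-≈ y≈z (sym x≤y))

  ≤-respˡ-≈ : ∀ {x y z} → x ≈ y → x ≤ z → y ≤ z
  ≤-respˡ-≈ x≈y x≤z = sym (O.≤-respˡ-≈ x≈y (sym x≤z))

  x∧y≤x : ∀ x y → x ∧ y ≤ x
  x∧y≤x x y = sym (O.x∧y≤x x y)

  x∧y≤y : ∀ x y → x ∧ y ≤ y
  x∧y≤y x y = sym (O.x∧y≤y x y)

  ∧-greatest : ∀ {x y z} → x ≤ y → x ≤ z → x ≤ y ∧ z
  ∧-greatest x≤y x≤z = sym (O.∧-greatest (sym x≤y) (sym x≤z))

  x≤x∨y : ∀ x y → x ≤ x ∨ y
  x≤x∨y x y = sym (O.x≤x∨y x y)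

  ≤⇒∨≈ʳ : ∀ {x y} → x ≤ y → y ≈ x ∨ y
  ≤⇒∨≈ʳ x≤y = O.antisym (O.y≤x∨y _ _) (O.∨-least (sym x≤y) O.refl)

module LatticeMaps {c₁ ℓ₁ c₂ ℓ₂} (L₁ : Lattice c₁ ℓ₁) (L₂ : Lattice c₂ ℓ₂)
                   (φ : Lattice.Carrier L₁ → Lattice.Carrier L₂)
                   (φ-cong : ∀ {x y} → Lattice._≈_ L₁ x y → Lattice._≈_ L₂ (φ x) (φ y))
                   where
  private
    module L₁ = Lattice L₁
    module L₂ = Lattice L₂
    module O₁ = LatticeOrder L₁
    module O₂ = LatticeOrder L₂

  ∨-homomorphic⇒monotone : (∀ x y → φ (x L₁.∨ y) L₂.≈ φ x L₂.∨ φ y)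
                          → ∀ {x y} → x O₁.≤ y → φ x O₂.≤ φ y
  ∨-homomorphic⇒monotone φ-∨ {x} {y} x≤y =
    O₂.≤-respʳ-≈ (L₂.trans (L₂.sym (φ-∨ x y)) (φ-cong (L₁.sym (O₁.≤⇒∨≈ʳ x≤y))))
                 (O₂.x≤x∨y (φ x) (φ y))

  ∧-homomorphic⇒monotone : (∀ x y → φ (x L₁.∧ y) L₂.≈ φ x L₂.∧ φ y)
                          → ∀ {x y} → x O₁.≤ y → φ x O₂.≤ φ y
  ∧-homomorphic⇒monotone φ-∧ {x} {y} x≤y = L₂.trans (L₂.sym (φ-∧ x y)) (φ-cong x≤y)

  ∨-to-∧⇒antitone : (∀ x y → φ (x L₁.∨ y) L₂.≈ φ x L₂.∧ φ y)
                   → ∀ {x y} → x O₁.≤ y → φ y O₂.≤ φ x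
  ∨-to-∧⇒antitone φ-∨ {x} {y} x≤y =
    O₂.≤-respˡ-≈ (L₂.trans (L₂.sym (φ-∨ x y)) (φ-cong (L₁.sym (O₁.≤⇒∨≈ʳ x≤y))))
                 (O₂.x∧y≤x (φ x) (φ y))

module FIDLModuleProperties {a ℓa b ℓb} (M : FIDLModule a ℓa b ℓb) where
  open FIDLModule M
  private
    module OA = LatticeOrder A.lattice
    module OB = LatticeOrder B.lattice

  f-monotoneˡ : ∀ h {x y} → x A.≤ y → f x h A.≤ f y h
  f-monotoneˡ h = LatticeMaps.∨-homomorphic⇒monotone A.lattice A.lattice
                    (λ x → f x h) (λ x≈y → f-cong x≈y B.refl) (λ x y → f-∨ˡ x y h)

  f-monotoneʳ : ∀ x {h k} → h B.≤ k → f x h A.≤ f x k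
  f-monotoneʳ x = LatticeMaps.∨-homomorphic⇒monotone B.lattice A.lattice
                    (f x) (f-cong A.refl) (f-∨ʳ x)

  f-monotone : ∀ {x y h k} → x A.≤ y → h B.≤ k → f x h A.≤ f y k
  f-monotone x≤y h≤k = OA.≤-trans (f-monotoneˡ _ x≤y) (f-monotoneʳ _ h≤k)

  i-monotoneʳ : ∀ h {x y} → x A.≤ y → i h x A.≤ i h y
  i-monotoneʳ h = LatticeMaps.∧-homomorphic⇒monotone A.lattice A.lattice
                    (i h) (i-cong B.refl) (i-∧ʳ h)

  i-antitoneˡ : ∀ x {h k} → h B.≤ k → i k x A.≤ i h x
  i-antitoneˡ x = LatticeMaps.∨-to-∧⇒antitone B.lattice A.lattice
                    (λ h → i h x) (λ h≈k → i-cong h≈k A.refl) (λ h k → i-∨ˡ h k x)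

  module _ {p q} {G : A.Carrier → Set p} {H : B.Carrier → Set q}
           (G-filter : IsFilter 𝐀 G) (H-filter : IsFilter 𝐁 H) where
    private
      module G = IsFilter G-filter
      module H = IsFilter H-filter

    fImage-⊤ : fImage G H A.⊤
    fImage-⊤ = A.⊤ , B.⊤ , G.contains-⊤ , H.contains-⊤ , A.∧-identityʳ _

    fImage-increasing : ∀ {x y} → x A.≤ y → fImage G H x → fImage G H y
    fImage-increasing x≤y (g , h , g∈G , h∈H , fgh≤x) =
      g , h , g∈G , h∈H , OA.≤-trans fgh≤x x≤y

    fImage-∧-closed : ∀ {x y} → fImage G H x → fImage G H y → fImage G H (x A.∧ y)
    fImage-∧-closed (g₁ , h₁ , g₁∈G , h₁∈H , f₁≤x) (g₂ , h₂ , g₂∈G , h₂∈H , f₂≤y) =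
      g₁ A.∧ g₂ , h₁ B.∧ h₂ , G.∧-closed g₁∈G g₂∈G , H.∧-closed h₁∈H h₂∈H ,
      OA.∧-greatest
        (OA.≤-trans (f-monotone (OA.x∧y≤x g₁ g₂) (OB.x∧y≤x h₁ h₂)) f₁≤x)
        (OA.≤-trans (f-monotone (OA.x∧y≤y g₁ g₂) (OB.x∧y≤y h₁ h₂)) f₂≤y)

    fImage-isFilter : IsFilter 𝐀 (fImage G H)
    fImage-isFilter = record
      { nonempty   = A.⊤ , fImage-⊤
      ; contains-⊤ = fImage-⊤
      ; increasing = fImage-increasing
      ; ∧-closed   = fImage-∧-closed
      }

    iImage-⊤ : iImage H G A.⊤
    iImage-⊤ = B.⊤ , A.⊤ , H.contains-⊤ , G.contains-⊤ ,
               OA.≤-respʳ-≈ (A.sym (i-⊤ B.⊤)) (A.∧-identityʳ A.⊤)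

    iImage-increasing : ∀ {x y} → x A.≤ y → iImage H G x → iImage H G y
    iImage-increasing x≤y (h , g , h∈H , g∈G , g≤ihx) =
      h , g , h∈H , g∈G , OA.≤-trans g≤ihx (i-monotoneʳ h x≤y)

    iImage-∧-closed : ∀ {x y} → iImage H G x → iImage H G y → iImage H G (x A.∧ y)
    iImage-∧-closed {x} {y} (h₁ , g₁ , h₁∈H , g₁∈G , g₁≤i₁) (h₂ , g₂ , h₂∈H , g₂∈G , g₂≤i₂) =
      h₁ B.∧ h₂ , g₁ A.∧ g₂ , H.∧-closed h₁∈H h₂∈H , G.∧-closed g₁∈G g₂∈G ,
      OA.≤-respʳ-≈ (A.sym (i-∧ʳ (h₁ B.∧ h₂) x y))
        (OA.∧-greatest
          (OA.≤-trans (OA.x∧y≤x g₁ g₂) (OA.≤-trans g₁≤i₁ (i-antitoneˡ x (OB.x∧y≤x h₁ h₂))))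
          (OA.≤-trans (OA.x∧y≤y g₁ g₂) (OA.≤-trans g₂≤i₂ (i-antitoneˡ y (OB.x∧y≤y h₁ h₂)))))

    iImage-isFilter : IsFilter 𝐀 (iImage H G)
    iImage-isFilter = record
      { nonempty   = A.⊤ , iImage-⊤
      ; contains-⊤ = iImage-⊤
      ; increasing = iImage-increasing
      ; ∧-closed   = iImage-∧-closed
      }

proposition3p7 : ∀ {a ℓa b ℓb p q : Level} (M : FIDLModule a ℓa b ℓb)
    → (G : BoundedDistributiveLattice.Carrier (FIDLModule.𝐀 M) → Set p)
    → (H : BoundedDistributiveLattice.Carrier (FIDLModule.𝐁 M) → Set q)
    → IsFilter (FIDLModule.𝐀 M) G
    → IsFilter (FIDLModule.𝐁 M) H
    → IsFilter (FIDLModule.𝐀 M) (FIDLModule.fImage M G H)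
    × IsFilter (FIDLModule.𝐀 M) (FIDLModule.iImage M H G)
proposition3p7 M G H G-filter H-filter =
  fImage-isFilter G-filter H-filter , iImage-isFilter G-filter H-filter
  where open FIDLModuleProperties M
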